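{- Let $\Gamma$ be a commutative weakly distance-regular digraph whose underlying graph $\Sigma$ is distance-regular with $c_2=2$. Let $p\ge2$ with $p^{(1,p-1)}_{(2,2),(p-1,1)}\ne0$. Then $p^{(1,t-1)}_{(2,2),(r-1,1)}=0$ for all integers $r,t\ge2$ with $t\ne p$.
   Context: Digraphs have arcs as ordered pairs of distinct vertices; $\partial_\Gamma$ is directed distance, $\tilde\partial_\Gamma(x,y)=(\partial_\Gamma(x,y),\partial_\Gamma(y,x))$, $\tilde\partial(\Gamma)$ is the set of these pairs, $P_{\tilde i,\tilde j}(x,y)=\{z:\tilde\partial_\Gamma(x,z)=\tilde i,\tilde\partial_\Gamma(z,y)=\tilde j\}$. A strongly connected $\Gamma$ is weakly distance-regular if $|P_{\tilde i,\tilde j}(x,y)|=p^{\tilde h}_{\tilde i,\tilde j}$ depends only on $\tilde i,\tilde j$ and $\tilde h=\tilde\partial_\Gamma(x,y)$ (with the convention $p^{\tilde h}_{\tilde i,\tilde j}=0$ if any index is not in $\tilde\partial(\Gamma)$); commutative if $p^{\tilde h}_{\tilde i,\tilde j}=p^{\tilde h}_{\tilde j,\tilde i}$. The underlying graph $\Sigma$ has $x\sim y$ iff $(x,y)$ or $(y,x)$ is an arc; $c_2$ is the number of common neighbours in $\Sigma$ of two vertices at distance $2$. -}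

module Defs where

open import Data.Nat using (ℕ; zero; suc; _<_)
open import Data.Fin using (Fin)
open import Data.Product using (Σ; ∃; _×_; _,_)
open import Data.Sum using (_⊎_)
open import Data.List using (List; length)
open import Data.List.Membership.Propositional using (_∈_)
open import Data.List.Relation.Unary.Unique.Propositional using (Unique)
open import Relation.Nullary using (¬_)
open import Relation.Binary.PropositionalEquality using (_≡_)
open import Function.Bundles using (_⇔_)

-- A digraph on the finite vertex set Fin n is given by its arc relation.
-- Arcs are ordered pairs of distinct vertices.
Irreflexive : ∀ {n} → (Fin n → Fin n → Set) → Set
Irreflexive {n} A = ∀ (x : Fin n) → ¬ A x x

HasSize : ∀ {n} → (Fin n → Set) → ℕ → Set
HasSize {n} P c = Σ (List (Fin n)) λ zs →
  Unique zs × (∀ z → (z ∈ zs) ⇔ P z) × length zs ≡ c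

module _ {n : ℕ} (A : Fin n → Fin n → Set) where

  data Walk : Fin n → Fin n → ℕ → Set where
    here : ∀ {x} → Walk x x zero
    step : ∀ {x y z k} → A x y → Walk y z k → Walk x z (suc k)

  DDist : Fin n → Fin n → ℕ → Set
  DDist x y d = Walk x y d × (∀ m → m < d → ¬ Walk x y m)

  StronglyConnected : Set
  StronglyConnected = ∀ x y → ∃ λ k → Walk x y k

  TDist : Fin n → Fin n → ℕ × ℕ → Set
  TDist x y (i , j) = DDist x y i × DDist y x j

  InSpec : ℕ × ℕ → Set
  InSpec h = ∃ λ x → ∃ λ y → TDist x y h

  P : ℕ × ℕ → ℕ × ℕ → Fin n → Fin n → Fin n → Set
  P i j x y z = TDist x z i × TDist z y j

  -- Γ is weakly distance-regular with intersection numbers p h i j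
  -- (p^h_{i,j}), including the convention that p^h_{i,j} = 0 whenever
  -- one of the indices is not in ∂̃(Γ).
  IsWDRWith : (ℕ × ℕ → ℕ × ℕ → ℕ × ℕ → ℕ) → Set
  IsWDRWith p =
    StronglyConnected
    × (∀ x y h i j → TDist x y h → HasSize (P i j x y) (p h i j))
    × (∀ h i j → (¬ InSpec h ⊎ ¬ InSpec i ⊎ ¬ InSpec j) → p h i j ≡ 0)

  CommutativeNums : (ℕ × ℕ → ℕ × ℕ → ℕ × ℕ → ℕ) → Set
  CommutativeNums p = ∀ h i j → p h i j ≡ p h j i

Adj : ∀ {n} → (Fin n → Fin n → Set) → Fin n → Fin n → Set
Adj A x y = A x y ⊎ A y x

UDist : ∀ {n} → (Fin n → Fin n → Set) → Fin n → Fin n → ℕ → Set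
UDist A = DDist (Adj A)

DistanceRegular : ∀ {n} → (Fin n → Fin n → Set) → Set
DistanceRegular A = ∃ λ (q : ℕ → ℕ → ℕ → ℕ) →
  ∀ x y h i j → UDist A x y h →
    HasSize (λ z → UDist A x z i × UDist A z y j) (q h i j)

C2Is : ∀ {n} → (Fin n → Fin n → Set) → ℕ → Set
C2Is A c = ∀ x y → UDist A x y 2 →
  HasSize (λ z → Adj A x z × Adj A z y) c

{-# OPTIONS --safe #-}
module Submission where

-- Suppose both numbers were nonzero and fix x, z with ∂̃(x,z) = (2,2). Weak
-- distance-regularity transports the two configurations to the pair (x,z) in
-- both directions: x → a → z with ∂(a,x) = t-1, x → b → z with ∂(b,x) = q-1,
-- and z → c → x, z → d → x likewise. All four are common neighbours of x and z
-- in Σ, so c₂ = 2 forces coincidences, and each possible coincidence equates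
-- two directed distances in a way that gives t = q.

open import Defs
open import Data.Nat using (ℕ; zero; suc; _≤_; _<_; _∸_; z≤n; s≤s)
open import Data.Nat.Properties using (<-cmp; _≟_; <⇒≤; ∸-cancelʳ-≡)
open import Data.Fin using (Fin)
open import Data.Product using (_×_; _,_; ∃; proj₁; proj₂; swap)
open import Data.Sum using (_⊎_; inj₁; inj₂)
open import Data.Empty using (⊥-elim)
open import Data.List using ([]; _∷_)
open import Data.List.Membership.Propositional using (_∈_)
open import Data.List.Relation.Unary.Any using (here; there)
open import Relation.Nullary using (¬_)
open import Relation.Nullary.Decidable using (decidable-stable)
open import Relation.Binary.PropositionalEquality using (_≡_; _≢_; refl; trans; subst)
open import Relation.Binary.Definitions using (tri<; tri≈; tri>)
open import Function.Bundles using (Equivalence)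

module _ {n : ℕ} where

  HasSize-nonEmpty : ∀ {Q : Fin n → Set} {c} → HasSize Q c → c ≢ 0 → ∃ Q
  HasSize-nonEmpty ([] , _ , _ , refl) c≢0 = ⊥-elim (c≢0 refl)
  HasSize-nonEmpty (z ∷ _ , _ , iff , _) _ = z , Equivalence.to (iff z) (here refl)

  HasSize-nonZero : ∀ {Q : Fin n → Set} {c z} → HasSize Q c → Q z → c ≢ 0
  HasSize-nonZero ([] , _ , iff , _) Qz _ with Equivalence.from (iff _) Qz
  ... | ()
  HasSize-nonZero (_ ∷ _ , _ , _ , refl) _ ()

  pigeonhole-pair : ∀ {u v a b c : Fin n} → a ∈ u ∷ v ∷ [] → b ∈ u ∷ v ∷ [] → c ∈ u ∷ v ∷ [] →
                    a ≡ b ⊎ c ≡ a ⊎ c ≡ b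
  pigeonhole-pair (here refl)         (here refl)         _                   = inj₁ refl
  pigeonhole-pair (there (here refl)) (there (here refl)) _                   = inj₁ refl
  pigeonhole-pair (here refl)         (there (here refl)) (here refl)         = inj₂ (inj₁ refl)
  pigeonhole-pair (here refl)         (there (here refl)) (there (here refl)) = inj₂ (inj₂ refl)
  pigeonhole-pair (there (here refl)) (here refl)         (here refl)         = inj₂ (inj₂ refl)
  pigeonhole-pair (there (here refl)) (here refl)         (there (here refl)) = inj₂ (inj₁ refl)
  pigeonhole-pair (there (there ())) _ _
  pigeonhole-pair _ (there (there ())) _
  pigeonhole-pair _ _ (there (there ()))

  HasSize-2-pigeonhole : ∀ {Q : Fin n → Set} {a b c} → HasSize Q 2 → Q a → Q b → Q c →
                         a ≡ b ⊎ c ≡ a ⊎ c ≡ b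
  HasSize-2-pigeonhole (_ ∷ _ ∷ [] , _ , iff , refl) Qa Qb Qc =
    pigeonhole-pair (Equivalence.from (iff _) Qa) (Equivalence.from (iff _) Qb) (Equivalence.from (iff _) Qc)

module _ {n : ℕ} {R : Fin n → Fin n → Set} where

  Walk-map : ∀ {S : Fin n → Fin n → Set} → (∀ {x y} → R x y → S x y) →
             ∀ {x y k} → Walk R x y k → Walk S x y k
  Walk-map f here       = here
  Walk-map f (step e w) = step (f e) (Walk-map f w)

  Walk-0⇒≡ : ∀ {x y} → Walk R x y 0 → x ≡ y
  Walk-0⇒≡ here = refl

  Walk-1⇒edge : ∀ {x y} → Walk R x y 1 → R x y
  Walk-1⇒edge (step e here) = e

  edge⇒Walk-1 : ∀ {x y} → R x y → Walk R x y 1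
  edge⇒Walk-1 e = step e here

  DDist-unique : ∀ {x y i j} → DDist R x y i → DDist R x y j → i ≡ j
  DDist-unique {i = i} {j} (wi , minimal-i) (wj , minimal-j) with <-cmp i j
  ... | tri< i<j _ _ = ⊥-elim (minimal-j i i<j wi)
  ... | tri≈ _ i≡j _ = i≡j
  ... | tri> _ _ j<i = ⊥-elim (minimal-i j j<i wj)

  DDist-1⇒edge : ∀ {x y} → DDist R x y 1 → R x y
  DDist-1⇒edge (w , _) = Walk-1⇒edge w

module _ {n : ℕ} (A : Fin n → Fin n → Set) where

  TDist-swap : ∀ {x y i j} → TDist A x y (i , j) → TDist A y x (j , i)
  TDist-swap = swap

  TDist-2-2⇒UDist-2 : ∀ {x z} → TDist A x z (2 , 2) → UDist A x z 2
  TDist-2-2⇒UDist-2 {x} {z} ((xz , minimal-xz) , (_ , minimal-zx)) = Walk-map inj₁ xz , shorter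
    where
    shorter : ∀ m → m < 2 → ¬ Walk (Adj A) x z m
    shorter zero _ w =
      minimal-xz 0 (s≤s z≤n) (subst (λ y → Walk A x y 0) (Walk-0⇒≡ w) here)
    shorter (suc zero) _ w with Walk-1⇒edge w
    ... | inj₁ x→z = minimal-xz 1 (s≤s (s≤s z≤n)) (edge⇒Walk-1 x→z)
    ... | inj₂ z→x = minimal-zx 1 (s≤s (s≤s z≤n)) (edge⇒Walk-1 z→x)
    shorter (suc (suc _)) (s≤s (s≤s ())) _

  module _ {p : ℕ × ℕ → ℕ × ℕ → ℕ × ℕ → ℕ} (wdr : IsWDRWith A p) where

    private
      sizes : ∀ x y h i j → TDist A x y h → HasSize (P A i j x y) (p h i j)
      sizes = proj₁ (proj₂ wdr)

      vanishes : ∀ h i j → ¬ InSpec A h ⊎ ¬ InSpec A i ⊎ ¬ InSpec A j → p h i j ≡ 0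
      vanishes = proj₂ (proj₂ wdr)

    nonzero⇒¬¬P : ∀ {h i j} → p h i j ≢ 0 →
                  ¬ ¬ ∃ λ x → ∃ λ y → TDist A x y h × ∃ (P A i j x y)
    nonzero⇒¬¬P {h} {i} {j} p≢0 noWitness = p≢0 (vanishes h i j (inj₁ λ (x , y , xy) →
      noWitness (x , y , xy , HasSize-nonEmpty (sizes x y h i j xy) p≢0)))

    -- y ∈ P_{h,jᵀ}(x,z) shows p^i_{h,jᵀ} ≠ 0, so P_{h,jᵀ}(u,w) is inhabited for every (u,w) at i.
    P-transpose : ∀ {x y z h i j₁ j₂} → TDist A x y h → P A i (j₁ , j₂) x y z →
                  ∀ {u w} → TDist A u w i → ∃ (P A h (j₂ , j₁) u w)
    P-transpose xy (xz , zy) uw = HasSize-nonEmpty (sizes _ _ _ _ _ uw)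
      (HasSize-nonZero (sizes _ _ _ _ _ xz) (xy , TDist-swap zy))

  P⇒common-neighbour : ∀ {x z w l m} → P A (1 , l) (1 , m) x z w → Adj A x w × Adj A w z
  P⇒common-neighbour ((xw , _) , (wz , _)) = inj₁ (DDist-1⇒edge xw) , inj₁ (DDist-1⇒edge wz)

  P⇒common-neighbourᵀ : ∀ {x z w l m} → P A (1 , l) (1 , m) z x w → Adj A x w × Adj A w z
  P⇒common-neighbourᵀ ((zw , _) , (wx , _)) = inj₂ (DDist-1⇒edge wx) , inj₂ (DDist-1⇒edge zw)

  common-neighbours-distances-agree : C2Is A 2 → ∀ {x z a b c d i j k} → TDist A x z (2 , 2) →
    P A (1 , i) (1 , j) x z a → P A (1 , k) (1 , k) x z b →
    P A (1 , i) (1 , j) z x c → P A (1 , k) (1 , k) z x d → i ≡ k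
  common-neighbours-distances-agree c2 {x} {z} xz
    a@((_ , ax) , (az , _)) b@((_ , bx) , (bz , _)) c@((_ , cz) , (cx , _)) d@((_ , dz) , (dx , _))
    with HasSize-2-pigeonhole (c2 x z (TDist-2-2⇒UDist-2 xz))
           (P⇒common-neighbour a) (P⇒common-neighbour b) (P⇒common-neighbourᵀ c)
       | HasSize-2-pigeonhole (c2 x z (TDist-2-2⇒UDist-2 xz))
           (P⇒common-neighbour a) (P⇒common-neighbour b) (P⇒common-neighbourᵀ d)
  ... | inj₁ refl | _ = DDist-unique ax bx
  ... | _ | inj₁ refl = DDist-unique ax bx
  ... | inj₂ (inj₁ refl) | inj₂ (inj₁ refl) = DDist-unique cz dz
  ... | inj₂ (inj₂ refl) | inj₂ (inj₂ refl) = DDist-unique cz dz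
  ... | inj₂ (inj₁ refl) | inj₂ (inj₂ refl) = trans (DDist-unique ax cx) (DDist-unique dx bx)
  ... | inj₂ (inj₂ refl) | inj₂ (inj₁ refl) = trans (DDist-unique cz bz) (DDist-unique az dz)

lemma3p2 : ∀ {n} (A : Fin n → Fin n → Set) → Irreflexive A →
    (p : ℕ × ℕ → ℕ × ℕ → ℕ × ℕ → ℕ) → IsWDRWith A p → CommutativeNums A p →
    DistanceRegular A → C2Is A 2 →
    ∀ (q : ℕ) → 2 ≤ q → p (1 , q ∸ 1) (2 , 2) (q ∸ 1 , 1) ≢ 0 →
    ∀ (r t : ℕ) → 2 ≤ r → 2 ≤ t → t ≢ q →
    p (1 , t ∸ 1) (2 , 2) (r ∸ 1 , 1) ≡ 0
lemma3p2 A _ p wdr _ _ c2 q 2≤q pq≢0 r t _ 2≤t t≢q =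
  decidable-stable (p (1 , t ∸ 1) (2 , 2) (r ∸ 1 , 1) ≟ 0) λ pt≢0 →
  nonzero⇒¬¬P A wdr pt≢0 λ (_ , _ , xy , _ , t-triangle@(xz , _)) →
  nonzero⇒¬¬P A wdr pq≢0 λ (_ , _ , x′y′ , _ , q-triangle) →
  t≢q (∸-cancelʳ-≡ (<⇒≤ 2≤t) (<⇒≤ 2≤q)
       (common-neighbours-distances-agree A c2 xz
         (proj₂ (P-transpose A wdr xy t-triangle xz))
         (proj₂ (P-transpose A wdr x′y′ q-triangle xz))
         (proj₂ (P-transpose A wdr xy t-triangle (TDist-swap A xz)))
         (proj₂ (P-transpose A wdr x′y′ q-triangle (TDist-swap A xz)))))
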